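{- Let $k \in \mathbb{Z}$ and $n \in\mathbb{Z}^+$ with $n\geq 2$ and $k\not\equiv 0\pmod n$, and let $R_4$ be the regular infinite square tiling of the plane (the graph on $\mathbb{Z}\times\mathbb{Z}$ with $(i,j)$ adjacent to $(i\pm1,j)$ and $(i,j\pm1)$). Then $\chi_{(n,k)}(R_4) = 2$ if $(4,n) \mid k$, and $\chi_{(n,k)}(R_4) = 4$ otherwise.
   Context: $(a,b)$ denotes the greatest common divisor. For a graph $G=(V,E)$, a $\mathbb{Z}$-labeling is a map $\ell:V\to\mathbb{Z}$; its order is the size of its range; it is proper if adjacent vertices get different labels. $N(v)$ is the open neighborhood of $v$. An open coloring with remainder $k \bmod n$ is a labeling with $\sum_{w\in N(v)}\ell(w)\equiv k \pmod n$ for all $v\in V$. $\chi_{(n,k)}(G)$ is the minimum order of a proper open coloring with remainder $k\bmod n$ (when one of finite order exists). -}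

module Defs where

open import Data.Nat using (ℕ; _≤_)
open import Data.Integer using (ℤ; +_; _+_; _-_; 1ℤ)
open import Data.Integer.Divisibility using (_∣_)
open import Data.Fin using (Fin)
open import Data.List using (List; []; _∷_; map; foldr)
open import Data.List.Membership.Propositional using (_∈_)
open import Data.Product using (Σ; ∃; _×_; _,_)
open import Function.Definitions using (Injective)
open import Relation.Binary.PropositionalEquality using (_≡_; _≢_)

V : Set
V = ℤ × ℤ

N : V → List V
N (i , j) = (i + 1ℤ , j) ∷ (i - 1ℤ , j) ∷ (i , j + 1ℤ) ∷ (i , j - 1ℤ) ∷ []

Adj : V → V → Set
Adj v w = w ∈ N v

Labeling : Set
Labeling = V → ℤ

-- sum of labels over N(v) (the four neighbours are distinct)
nsum : Labeling → V → ℤ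
nsum ℓ v = foldr _+_ (+ 0) (map ℓ (N v))

_≡_[mod_] : ℤ → ℤ → ℕ → Set
a ≡ b [mod n ] = (+ n) ∣ (a - b)

Proper : Labeling → Set
Proper ℓ = ∀ v w → Adj v w → ℓ v ≢ ℓ w

OpenColoring : ℕ → ℤ → Labeling → Set
OpenColoring n k ℓ = ∀ v → nsum ℓ v ≡ k [mod n ]

HasOrder : Labeling → ℕ → Set
HasOrder ℓ m = Σ (Fin m → ℤ) λ f →
  Injective _≡_ _≡_ f × (∀ v → ∃ λ i → ℓ v ≡ f i) × (∀ i → ∃ λ v → ℓ v ≡ f i)

-- χ_(n,k)(R₄) = c : c is the minimum order of a proper open coloring
-- with remainder k mod n (among those of finite order)
Chi≡ : ℕ → ℤ → ℕ → Set
Chi≡ n k c =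
  (Σ Labeling λ ℓ → Proper ℓ × OpenColoring n k ℓ × HasOrder ℓ c) ×
  (∀ ℓ m → Proper ℓ → OpenColoring n k ℓ → HasOrder ℓ m → c ≤ m)

{-# OPTIONS --safe #-}

-- Upper bounds: labelings periodic modulo 4 of the form ℓ = e·X + p·n, with p the parity
-- of i + j, so that adjacent labels differ in their multiple of n.  For e ≡ 1 (labels X and
-- X + n) every neighbour sum is 4X, and 4X ≡ k (mod n) is solvable exactly when
-- gcd(4, n) ∣ k.  For X = k and e the indicator of a perfect code, a set meeting every
-- neighbourhood exactly once, every neighbour sum is ≡ k and there are four labels.
--
-- Lower bound 4: if gcd(4, n) ∤ k then no 4X is ≡ k.  When ℓ takes at most three values,
-- the neighbours of a vertex v carry the two labels other than ℓ v, and a corner between two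
-- differently labelled neighbours carries ℓ v.  Each arrangement of the four neighbours
-- (three alike, alternating pairs, adjacent pairs) then forces an integer combination with
-- coefficients summing to 1 of nearby neighbour sums, hence ≡ k, to equal some 4X.

module Submission where

open import Defs
open import Data.Nat using (ℕ; _≥_)
open import Data.Nat.GCD using (gcd)
open import Data.Integer using (ℤ; +_)
open import Data.Integer.Divisibility using (_∣_)
open import Data.Product using (_×_)
open import Relation.Nullary using (¬_)

open import Data.Empty using (⊥; ⊥-elim)
open import Data.Fin using (Fin; suc; toℕ; combine; remQuot)
open import Data.Fin.Patterns using (0F; 1F; 2F; 3F)
open import Data.Fin.Properties using (all?; pigeonhole; remQuot-combine; combine-remQuot; toℕ-injective)
import Data.Fin.Properties as Fin
open import Data.Integer using (-[1+_]; _+_; _-_; _*_; -_; 1ℤ; 0ℤ)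
open import Data.Integer.Divisibility.Signed as Signed
  using (divides; ∣ᵤ⇒∣; ∣⇒∣ᵤ; ∣m∣n⇒∣m+n; ∣m∣n⇒∣m-n; ∣n⇒∣m*n; ∣m⇒∣m*n; ∣m⇒∣-m; ∣-refl; ∣-trans)
open import Data.Integer.Properties using (_≟_; pos-*)
import Data.Integer.Properties as ℤ
open import Algebra.Properties.AbelianGroup ℤ.+-0-abelianGroup using (∙-cancelˡ)
open import Data.Integer.Tactic.RingSolver using (solve-∀)
open import Data.List using (List; []; _∷_; map; foldr)
open import Data.List.Membership.Propositional using (_∈_)
open import Data.List.Membership.Propositional.Properties using (∈-map⁺)
open import Data.List.Properties using (map-∘)
open import Data.List.Relation.Unary.All using (All)
import Data.List.Relation.Unary.All as All
open import Data.List.Relation.Unary.Any using (here; there)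
import Data.Nat as ℕ
open import Data.Nat.DivMod using (_mod_)
open import Data.Nat.GCD using (gcd-GCD; gcd[m,n]∣m; gcd[m,n]∣n; module Bézout)
import Data.Nat.Properties as ℕ
open import Data.Product using (Σ; ∃; ∃₂; _,_; proj₁; proj₂; uncurry)
open import Data.Sum using (_⊎_; inj₁; inj₂)
open import Function using (_∘_)
open import Function.Definitions using (Injective)
open import Relation.Binary.PropositionalEquality
  using (_≡_; _≢_; refl; sym; trans; cong; subst; ≢-sym; module ≡-Reasoning)
open import Relation.Nullary using (yes; no; ¬?)
open import Relation.Nullary.Decidable using (toWitness)

-- Congruences and linear congruences

≡-mod-reflexive : ∀ {n x y} → x ≡ y → x ≡ y [mod n ]
≡-mod-reflexive {n} {x} refl = ∣⇒∣ᵤ {+ n} (divides 0ℤ (ℤ.+-inverseʳ x))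

≡-mod-affine : ∀ {n : ℕ} {k s₁ s₂ s₃ : ℤ} (a b c : ℤ) → a + b + c ≡ 1ℤ →
               s₁ ≡ k [mod n ] → s₂ ≡ k [mod n ] → s₃ ≡ k [mod n ] →
               (a * s₁ + b * s₂ + c * s₃) ≡ k [mod n ]
≡-mod-affine {n} {k} {s₁} {s₂} {s₃} a b c a+b+c≡1 n∣₁ n∣₂ n∣₃ =
  ∣⇒∣ᵤ (subst (Signed._∣_ (+ n)) (sym (expand a b c s₁ s₂ s₃ k))
    (∣m∣n⇒∣m+n (∣m∣n⇒∣m+n (∣m∣n⇒∣m+n (∣n⇒∣m*n a (∣ᵤ⇒∣ n∣₁)) (∣n⇒∣m*n b (∣ᵤ⇒∣ n∣₂))) (∣n⇒∣m*n c (∣ᵤ⇒∣ n∣₃)))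
               (subst (λ t → Signed._∣_ (+ n) ((t - 1ℤ) * k)) (sym a+b+c≡1) (divides 0ℤ refl))))
  where
  expand : ∀ a b c s₁ s₂ s₃ k → a * s₁ + b * s₂ + c * s₃ - k ≡
           a * (s₁ - k) + b * (s₂ - k) + c * (s₃ - k) + (a + b + c - 1ℤ) * k
  expand = solve-∀

pos-difference : ∀ g a b c d → g ℕ.+ a ℕ.* b ≡ c ℕ.* d → + g ≡ + c * + d - + a * + b
pos-difference g a b c d eq = begin
  + g                           ≡⟨ add-sub (+ g) (+ a * + b) ⟩
  + g + + a * + b - + a * + b   ≡⟨ cong (λ z → + g + z - + a * + b) (pos-* a b) ⟨
  + (g ℕ.+ a ℕ.* b) - + a * + b ≡⟨ cong (λ z → + z - + a * + b) eq ⟩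
  + (c ℕ.* d) - + a * + b       ≡⟨ cong (_- + a * + b) (pos-* c d) ⟩
  + c * + d - + a * + b         ∎
  where
  open ≡-Reasoning
  add-sub : ∀ g p → g ≡ g + p - p
  add-sub = solve-∀

bézoutℤ : ∀ m n → ∃₂ λ x y → + gcd m n ≡ + m * x + + n * y
bézoutℤ m n with Bézout.identity (gcd-GCD m n)
... | Bézout.+- x y eq = + x , - + y , trans (pos-difference _ y n x m eq) (rearrange (+ x) (+ m) (+ y) (+ n))
  where rearrange : ∀ x m y n → x * m - y * n ≡ m * x + n * - y
        rearrange = solve-∀
... | Bézout.-+ x y eq = - + x , + y , trans (pos-difference _ x m y n eq) (rearrange (+ x) (+ m) (+ y) (+ n))
  where rearrange : ∀ x m y n → y * n - x * m ≡ m * - x + n * y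
        rearrange = solve-∀

solvable⇒gcd∣ : ∀ m n {k X} → (+ m * X) ≡ k [mod n ] → (+ gcd m n) ∣ k
solvable⇒gcd∣ m n {k} {X} n∣mX-k = ∣⇒∣ᵤ (subst (Signed._∣_ (+ gcd m n)) (cancel (+ m * X) k)
  (∣m∣n⇒∣m-n (∣m⇒∣m*n X (∣ᵤ⇒∣ {+ gcd m n} {+ m} (gcd[m,n]∣m m n)))
              (∣-trans (∣ᵤ⇒∣ {+ gcd m n} {+ n} (gcd[m,n]∣n m n)) (∣ᵤ⇒∣ {+ n} {+ m * X - k} n∣mX-k))))
  where cancel : ∀ a k → a - (a - k) ≡ k
        cancel = solve-∀

gcd∣⇒solvable : ∀ m n {k} → (+ gcd m n) ∣ k → ∃ λ X → (+ m * X) ≡ k [mod n ]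
gcd∣⇒solvable m n {k} g∣k with ∣ᵤ⇒∣ g∣k | bézoutℤ m n
... | divides t k≡tg | x , y , g≡mx+ny = x * t , ∣⇒∣ᵤ (divides (- (t * y)) (begin
  + m * (x * t) - k                         ≡⟨ cong (_-_ (+ m * (x * t))) (trans k≡tg (cong (t *_) g≡mx+ny)) ⟩
  + m * (x * t) - t * (+ m * x + + n * y)   ≡⟨ cancel (+ m) (+ n) x y t ⟩
  - (t * y) * + n                           ∎))
  where
  open ≡-Reasoning
  cancel : ∀ m n x y t → m * (x * t) - t * (m * x + n * y) ≡ - (t * y) * n
  cancel = solve-∀

-- The square lattice

data Dir : Set where
  east north west south : Dir

infixl 6 _⊕_

_⊕_ : V → Dir → V
(i , j) ⊕ east  = i + 1ℤ , j
(i , j) ⊕ north = i , j + 1ℤ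
(i , j) ⊕ west  = i - 1ℤ , j
(i , j) ⊕ south = i , j - 1ℤ

⊕-adjacent : ∀ v d → Adj v (v ⊕ d)
⊕-adjacent (i , j) east  = here refl
⊕-adjacent (i , j) west  = there (here refl)
⊕-adjacent (i , j) north = there (there (here refl))
⊕-adjacent (i , j) south = there (there (there (here refl)))

-- A proof of CCW a b c d is a frame: the four directions in counterclockwise order from
-- any start.  Lemmas about an arbitrary frame cover all four orientations by `rotate`.
data CCW : Dir → Dir → Dir → Dir → Set where
  from-east  : CCW east north west south
  from-north : CCW north west south east
  from-west  : CCW west south east north
  from-south : CCW south east north west

rotate : ∀ {a b c d} → CCW a b c d → CCW b c d a
rotate from-east  = from-north
rotate from-north = from-west
rotate from-west  = from-south
rotate from-south = from-east

ccw-comm : ∀ {a b c d} → CCW a b c d → ∀ v → v ⊕ a ⊕ b ≡ v ⊕ b ⊕ a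
ccw-comm from-east  (i , j) = refl
ccw-comm from-north (i , j) = refl
ccw-comm from-west  (i , j) = refl
ccw-comm from-south (i , j) = refl

i+1-1≡i : ∀ i → i + 1ℤ - 1ℤ ≡ i
i+1-1≡i = solve-∀

i-1+1≡i : ∀ i → i - 1ℤ + 1ℤ ≡ i
i-1+1≡i = solve-∀

ccw-back : ∀ {a b c d} → CCW a b c d → ∀ v → v ⊕ a ⊕ c ≡ v
ccw-back from-east  (i , j) = cong (_, j) (i+1-1≡i i)
ccw-back from-north (i , j) = cong (i ,_) (i+1-1≡i j)
ccw-back from-west  (i , j) = cong (_, j) (i-1+1≡i i)
ccw-back from-south (i , j) = cong (i ,_) (i-1+1≡i j)

nsum-ccw : ∀ {a b c d} → CCW a b c d → ∀ ℓ v →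
           nsum ℓ v ≡ ℓ (v ⊕ a) + ℓ (v ⊕ b) + ℓ (v ⊕ c) + ℓ (v ⊕ d)
nsum-ccw from-east  ℓ (i , j) = shuffle (ℓ (i + 1ℤ , j)) (ℓ (i - 1ℤ , j)) (ℓ (i , j + 1ℤ)) (ℓ (i , j - 1ℤ))
  where shuffle : ∀ e w n s → e + (w + (n + (s + + 0))) ≡ e + n + w + s
        shuffle = solve-∀
nsum-ccw from-north ℓ (i , j) = shuffle (ℓ (i + 1ℤ , j)) (ℓ (i - 1ℤ , j)) (ℓ (i , j + 1ℤ)) (ℓ (i , j - 1ℤ))
  where shuffle : ∀ e w n s → e + (w + (n + (s + + 0))) ≡ n + w + s + e
        shuffle = solve-∀
nsum-ccw from-west  ℓ (i , j) = shuffle (ℓ (i + 1ℤ , j)) (ℓ (i - 1ℤ , j)) (ℓ (i , j + 1ℤ)) (ℓ (i , j - 1ℤ))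
  where shuffle : ∀ e w n s → e + (w + (n + (s + + 0))) ≡ w + s + e + n
        shuffle = solve-∀
nsum-ccw from-south ℓ (i , j) = shuffle (ℓ (i + 1ℤ , j)) (ℓ (i - 1ℤ , j)) (ℓ (i , j + 1ℤ)) (ℓ (i , j - 1ℤ))
  where shuffle : ∀ e w n s → e + (w + (n + (s + + 0))) ≡ s + e + n + w
        shuffle = solve-∀

-- Labelings with at most three values

AtMostThreeValues : Labeling → Set
AtMostThreeValues ℓ = ∀ {x y z w} → ℓ x ≢ ℓ y →
  ℓ z ≢ ℓ x → ℓ z ≢ ℓ y → ℓ w ≢ ℓ x → ℓ w ≢ ℓ y → ℓ z ≡ ℓ w

hasOrder⇒atMostThreeValues : ∀ {ℓ m} → HasOrder ℓ m → m ℕ.< 4 → AtMostThreeValues ℓ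
hasOrder⇒atMostThreeValues {ℓ} (f , _ , cover , _) m<4 {x} {y} {z} {w} x≢y z≢x z≢y w≢x w≢y =
  collision (pigeonhole m<4 (proj₁ ∘ cover ∘ pick))
  where
  pick : Fin 4 → V
  pick 0F = x
  pick 1F = y
  pick 2F = z
  pick 3F = w
  same-label : ∀ {u u′} → proj₁ (cover u) ≡ proj₁ (cover u′) → ℓ u ≡ ℓ u′
  same-label {u} {u′} eq = trans (proj₂ (cover u)) (trans (cong f eq) (sym (proj₂ (cover u′))))
  collision : (∃₂ λ i j → toℕ i ℕ.< toℕ j × proj₁ (cover (pick i)) ≡ proj₁ (cover (pick j))) → ℓ z ≡ ℓ w
  collision (0F , 1F , _ , e) = ⊥-elim (x≢y (same-label e))
  collision (0F , 2F , _ , e) = ⊥-elim (z≢x (sym (same-label e)))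
  collision (0F , 3F , _ , e) = ⊥-elim (w≢x (sym (same-label e)))
  collision (1F , 2F , _ , e) = ⊥-elim (z≢y (sym (same-label e)))
  collision (1F , 3F , _ , e) = ⊥-elim (w≢y (sym (same-label e)))
  collision (2F , 3F , _ , e) = same-label e
  collision (_ , 0F , () , _)
  collision (suc _ , 1F , ℕ.s≤s () , _)
  collision (suc (suc _) , 2F , ℕ.s≤s (ℕ.s≤s ()) , _)
  collision (3F , 3F , ℕ.s≤s (ℕ.s≤s (ℕ.s≤s ())) , _)

module ThreeValueObstruction {n : ℕ} {k : ℤ} {ℓ : Labeling}
  (proper : Proper ℓ) (sum≡k : OpenColoring n k ℓ) (three : AtMostThreeValues ℓ)
  (k≢4X : ∀ X → ¬ ((+ 4 * X) ≡ k [mod n ])) where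

  private variable a b c d : Dir

  step-≢ : ∀ v e → ℓ (v ⊕ e) ≢ ℓ v
  step-≢ v e = proper v (v ⊕ e) (⊕-adjacent v e) ∘ sym

  one-of : ∀ {x y z w} → ℓ x ≢ ℓ y → ℓ w ≢ ℓ x → ℓ w ≢ ℓ y → ℓ z ≢ ℓ y → ℓ z ≡ ℓ x ⊎ ℓ z ≡ ℓ w
  one-of {x} {z = z} x≢y w≢x w≢y z≢y with ℓ z ≟ ℓ x
  ... | yes z≡x = inj₁ z≡x
  ... | no  z≢x = inj₂ (three x≢y z≢x z≢y w≢x w≢y)

  sum-around : CCW a b c d → ∀ v {p q r s} →
               ℓ (v ⊕ a) ≡ p → ℓ (v ⊕ b) ≡ q → ℓ (v ⊕ c) ≡ r → ℓ (v ⊕ d) ≡ s → (p + q + r + s) ≡ k [mod n ]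
  sum-around F v refl refl refl refl = subst (_≡ k [mod n ]) (nsum-ccw F ℓ v) (sum≡k v)

  ¬uniform : ∀ x → (x + x + x + x) ≡ k [mod n ] → ⊥
  ¬uniform x = k≢4X x ∘ subst (_≡ k [mod n ]) (quadruple x)
    where quadruple : ∀ x → x + x + x + x ≡ + 4 * x
          quadruple = solve-∀

  ¬affine : ∀ s₁ s₂ s₃ (p q r X : ℤ) → p + q + r ≡ 1ℤ → p * s₁ + q * s₂ + r * s₃ ≡ + 4 * X →
            s₁ ≡ k [mod n ] → s₂ ≡ k [mod n ] → s₃ ≡ k [mod n ] → ⊥
  ¬affine s₁ s₂ s₃ p q r X p+q+r≡1 ≡4X ≡₁ ≡₂ ≡₃ =
    k≢4X X (subst (_≡ k [mod n ]) ≡4X (≡-mod-affine {s₁ = s₁} {s₂} {s₃} p q r p+q+r≡1 ≡₁ ≡₂ ≡₃))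

  corner : CCW a b c d → ∀ v → ℓ (v ⊕ a) ≢ ℓ (v ⊕ b) → ℓ (v ⊕ a ⊕ b) ≡ ℓ v
  corner {a} {b} F v a≢b =
    three a≢b (step-≢ (v ⊕ a) b) (subst (λ u → ℓ u ≢ ℓ (v ⊕ b)) (sym (ccw-comm F v)) (step-≢ (v ⊕ b) a))
          (≢-sym (step-≢ v a)) (≢-sym (step-≢ v b))

  corner′ : CCW a b c d → ∀ v → ℓ (v ⊕ a) ≢ ℓ (v ⊕ d) → ℓ (v ⊕ a ⊕ d) ≡ ℓ v
  corner′ {a} {b} {c} {d} F v a≢d = trans (cong ℓ (sym (ccw-comm F³ v))) (corner F³ v (≢-sym a≢d))
    where F³ : CCW d a b c
          F³ = rotate (rotate (rotate F))

  ¬three-one-sums : ∀ {α β γ x y} → x ≡ α ⊎ x ≡ γ → y ≡ α ⊎ y ≡ γ →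
                    (γ + β + β + β) ≡ k [mod n ] → (β + α + α + α) ≡ k [mod n ] → (α + x + y + α) ≡ k [mod n ] → ⊥
  ¬three-one-sums {α} (inj₁ refl) (inj₁ refl) _ _ sum₃ = ¬uniform α sum₃
  ¬three-one-sums {α} {β} {γ} (inj₁ refl) (inj₂ refl) =
    ¬affine (γ + β + β + β) (β + α + α + α) (α + α + γ + α) 1ℤ (- + 3) (+ 3) γ refl (identity α β γ)
    where identity : ∀ α β γ →
                     1ℤ * (γ + β + β + β) + (- + 3) * (β + α + α + α) + + 3 * (α + α + γ + α) ≡ + 4 * γ
          identity = solve-∀
  ¬three-one-sums {α} {β} {γ} (inj₂ refl) (inj₁ refl) =
    ¬affine (γ + β + β + β) (β + α + α + α) (α + γ + α + α) 1ℤ (- + 3) (+ 3) γ refl (identity α β γ)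
    where identity : ∀ α β γ →
                     1ℤ * (γ + β + β + β) + (- + 3) * (β + α + α + α) + + 3 * (α + γ + α + α) ≡ + 4 * γ
          identity = solve-∀
  ¬three-one-sums {α} {β} {γ} (inj₂ refl) (inj₂ refl) =
    ¬affine (γ + β + β + β) (β + α + α + α) (α + γ + γ + α) (+ 2) (+ 2) (- + 3) (+ 2 * β - γ) refl (identity α β γ)
    where identity : ∀ α β γ → + 2 * (γ + β + β + β) + + 2 * (β + α + α + α) + (- + 3) * (α + γ + γ + α)
                               ≡ + 4 * (+ 2 * β - γ)
          identity = solve-∀

  -- With α = ℓ v, β = ℓ (v ⊕ b) and γ = ℓ (v ⊕ a): v and two corners are neighbours of
  -- v ⊕ a labelled α, so its fourth neighbour is labelled α or β; two neighbours of v ⊕ b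
  -- are labelled α and the other two α or γ.
  ¬three-one : CCW a b c d → ∀ v → ℓ (v ⊕ c) ≡ ℓ (v ⊕ b) → ℓ (v ⊕ d) ≡ ℓ (v ⊕ b) →
               ℓ (v ⊕ a) ≢ ℓ (v ⊕ b) → ⊥
  ¬three-one {a} {b} {c} {d} F v c≡b d≡b a≢b =
    fourth (one-of (≢-sym (step-≢ v a)) (step-≢ v b) (≢-sym a≢b) (step-≢ (v ⊕ a) a))
    where
    ab : ℓ (v ⊕ a ⊕ b) ≡ ℓ v
    ab = corner F v a≢b
    ac : ℓ (v ⊕ a ⊕ c) ≡ ℓ v
    ac = cong ℓ (ccw-back F v)
    ad : ℓ (v ⊕ a ⊕ d) ≡ ℓ v
    ad = corner′ F v (λ a≡d → a≢b (trans a≡d d≡b))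
    α-or-γ : ∀ e → ℓ (v ⊕ b ⊕ e) ≡ ℓ v ⊎ ℓ (v ⊕ b ⊕ e) ≡ ℓ (v ⊕ a)
    α-or-γ e = one-of (≢-sym (step-≢ v b)) (step-≢ v a) a≢b (step-≢ (v ⊕ b) e)
    fourth : ℓ (v ⊕ a ⊕ a) ≡ ℓ v ⊎ ℓ (v ⊕ a ⊕ a) ≡ ℓ (v ⊕ b) → ⊥
    fourth (inj₁ aa) = ¬uniform (ℓ v) (sum-around F (v ⊕ a) aa ab ac ad)
    fourth (inj₂ aa) =
      ¬three-one-sums (α-or-γ b) (α-or-γ c)
        (sum-around F v refl refl c≡b d≡b)
        (sum-around F (v ⊕ a) aa ab ac ad)
        (sum-around F (v ⊕ b) (trans (cong ℓ (sym (ccw-comm F v))) ab) refl refl (cong ℓ (ccw-back (rotate F) v)))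

  ¬three-equal : CCW a b c d → ∀ v → ℓ (v ⊕ c) ≡ ℓ (v ⊕ b) → ℓ (v ⊕ d) ≡ ℓ (v ⊕ b) → ⊥
  ¬three-equal {a} {b} F v c≡b d≡b with ℓ (v ⊕ a) ≟ ℓ (v ⊕ b)
  ... | yes a≡b = ¬uniform (ℓ (v ⊕ b)) (sum-around F v a≡b refl c≡b d≡b)
  ... | no  a≢b = ¬three-one F v c≡b d≡b a≢b

  pair-forces : CCW a b c d → ∀ w {u} → ℓ (w ⊕ d) ≡ ℓ (w ⊕ c) → ℓ u ≢ ℓ w → ℓ u ≢ ℓ (w ⊕ c) →
                ℓ (w ⊕ a) ≡ ℓ u × ℓ (w ⊕ b) ≡ ℓ u
  pair-forces {a} {b} {c} F w d≡c u≢w u≢c =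
      three w≢c (step-≢ w a) (λ a≡c → ¬three-equal (rotate F) w d≡c a≡c) u≢w u≢c
    , three w≢c (step-≢ w b) (λ b≡c → ¬three-equal F w (sym b≡c) (trans d≡c (sym b≡c))) u≢w u≢c
    where w≢c : ℓ w ≢ ℓ (w ⊕ c)
          w≢c = ≢-sym (step-≢ w c)

  -- Each of v ⊕ b and v ⊕ c has two consecutive neighbours labelled α = ℓ v, which forces
  -- its other two; then the sums at v ⊕ b and v ⊕ c minus the sum at v give 4α.
  ¬two-two : CCW a b c d → ∀ v → ℓ (v ⊕ b) ≡ ℓ (v ⊕ a) → ℓ (v ⊕ d) ≡ ℓ (v ⊕ c) →
             ℓ (v ⊕ a) ≢ ℓ (v ⊕ c) → ⊥
  ¬two-two {a} {b} {c} {d} F v b≡a d≡c a≢c =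
    ¬affine (γ + γ + α + α) (α + α + β + β) (β + β + γ + γ) 1ℤ 1ℤ (- 1ℤ) α refl (identity α β γ)
            (sum-around F (v ⊕ b) (proj₁ at-b) (proj₂ at-b) bc bd)
            (sum-around F (v ⊕ c) ca cb (proj₁ at-c) (proj₂ at-c))
            (sum-around F v (sym b≡a) refl refl d≡c)
    where
    F′ : CCW b c d a
    F′ = rotate F
    F″ : CCW c d a b
    F″ = rotate F′
    α β γ : ℤ
    α = ℓ v
    β = ℓ (v ⊕ b)
    γ = ℓ (v ⊕ c)
    b≢c : β ≢ γ
    b≢c b≡c = a≢c (trans (sym b≡a) b≡c)
    bc : ℓ (v ⊕ b ⊕ c) ≡ α
    bc = corner F′ v b≢c
    bd : ℓ (v ⊕ b ⊕ d) ≡ α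
    bd = cong ℓ (ccw-back F′ v)
    ca : ℓ (v ⊕ c ⊕ a) ≡ α
    ca = cong ℓ (ccw-back F″ v)
    cb : ℓ (v ⊕ c ⊕ b) ≡ α
    cb = trans (cong ℓ (sym (ccw-comm F′ v))) bc
    at-b : ℓ (v ⊕ b ⊕ a) ≡ γ × ℓ (v ⊕ b ⊕ b) ≡ γ
    at-b = pair-forces F (v ⊕ b) (trans bd (sym bc)) (≢-sym b≢c) (λ γ≡ → step-≢ v c (trans γ≡ bc))
    at-c : ℓ (v ⊕ c ⊕ c) ≡ β × ℓ (v ⊕ c ⊕ d) ≡ β
    at-c = pair-forces F″ (v ⊕ c) (trans cb (sym ca)) b≢c (λ β≡ → step-≢ v b (trans β≡ ca))
    identity : ∀ α β γ → 1ℤ * (γ + γ + α + α) + 1ℤ * (α + α + β + β) + (- 1ℤ) * (β + β + γ + γ) ≡ + 4 * α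
    identity = solve-∀

  ¬alternating : CCW a b c d → ∀ v → ℓ (v ⊕ c) ≡ ℓ (v ⊕ a) → ℓ (v ⊕ d) ≡ ℓ (v ⊕ b) →
                 ℓ (v ⊕ a) ≢ ℓ (v ⊕ b) → ⊥
  ¬alternating {a} {b} {c} {d} F v c≡a d≡b a≢b = ¬three-equal F (v ⊕ a) (trans ac (sym ab)) (trans ad (sym ab))
    where
    ab : ℓ (v ⊕ a ⊕ b) ≡ ℓ v
    ab = corner F v a≢b
    ac : ℓ (v ⊕ a ⊕ c) ≡ ℓ v
    ac = cong ℓ (ccw-back F v)
    ad : ℓ (v ⊕ a ⊕ d) ≡ ℓ v
    ad = corner′ F v (λ a≡d → a≢b (trans a≡d d≡b))

  contradiction-at : CCW a b c d → V → ⊥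
  contradiction-at {a} {b} {c} {d} F v with ℓ (v ⊕ c) ≟ ℓ (v ⊕ a)
  ... | yes c≡a with ℓ (v ⊕ b) ≟ ℓ (v ⊕ a)
  ...   | yes b≡a = ¬three-equal (rotate (rotate (rotate F))) v b≡a c≡a
  ...   | no  b≢a with ℓ (v ⊕ d) ≟ ℓ (v ⊕ a)
  ...     | yes d≡a = ¬three-equal (rotate F) v (trans d≡a (sym c≡a)) (sym c≡a)
  ...     | no  d≢a = ¬alternating F v c≡a (three (≢-sym (step-≢ v a)) (step-≢ v d) d≢a (step-≢ v b) b≢a)
                                   (≢-sym b≢a)
  contradiction-at {a} {b} {c} {d} F v | no c≢a
    with one-of (step-≢ v a) c≢a (step-≢ v c) (step-≢ v b) | one-of (step-≢ v a) c≢a (step-≢ v c) (step-≢ v d)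
  ... | inj₁ b≡a | inj₁ d≡a = ¬three-equal (rotate (rotate F)) v (sym d≡a) (trans b≡a (sym d≡a))
  ... | inj₂ b≡c | inj₂ d≡c = ¬three-equal F v (sym b≡c) (trans d≡c (sym b≡c))
  ... | inj₁ b≡a | inj₂ d≡c = ¬two-two F v b≡a d≡c (≢-sym c≢a)
  ... | inj₂ b≡c | inj₁ d≡a = ¬two-two (rotate (rotate (rotate F))) v (sym d≡a) (sym b≡c)
                                (λ d≡b → c≢a (trans (sym b≡c) (trans (sym d≡b) d≡a)))

two-≤-order : ∀ {ℓ m} → Proper ℓ → HasOrder ℓ m → 2 ℕ.≤ m
two-≤-order {m = 0} _ (_ , _ , cover , _) with cover (+ 0 , + 0)
... | () , _
two-≤-order {m = 1} proper (_ , _ , cover , _) with cover (+ 0 , + 0) | cover (+ 1 , + 0)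
... | 0F , ℓv≡f0 | 0F , ℓw≡f0 = ⊥-elim (proper (+ 0 , + 0) (+ 1 , + 0) (here refl) (trans ℓv≡f0 (sym ℓw≡f0)))
two-≤-order {m = ℕ.suc (ℕ.suc _)} _ _ = ℕ.s≤s (ℕ.s≤s ℕ.z≤n)

four-≤-order : ∀ {n k} → (∀ X → ¬ ((+ 4 * X) ≡ k [mod n ])) →
               ∀ ℓ m → Proper ℓ → OpenColoring n k ℓ → HasOrder ℓ m → 4 ℕ.≤ m
four-≤-order k≢4X ℓ m proper sums order = ℕ.≮⇒≥ λ m<4 →
  ThreeValueObstruction.contradiction-at proper sums (hasOrder⇒atMostThreeValues order m<4) k≢4X
    from-east (+ 0 , + 0)

-- Labelings pulled back from the 4 × 4 torus

suc₄ pred₄ : Fin 4 → Fin 4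
suc₄ 0F = 1F
suc₄ 1F = 2F
suc₄ 2F = 3F
suc₄ 3F = 0F
pred₄ 0F = 3F
pred₄ 1F = 0F
pred₄ 2F = 1F
pred₄ 3F = 2F

suc₄-pred₄ : ∀ x → suc₄ (pred₄ x) ≡ x
suc₄-pred₄ 0F = refl
suc₄-pred₄ 1F = refl
suc₄-pred₄ 2F = refl
suc₄-pred₄ 3F = refl

pred₄-suc₄ : ∀ x → pred₄ (suc₄ x) ≡ x
pred₄-suc₄ 0F = refl
pred₄-suc₄ 1F = refl
pred₄-suc₄ 2F = refl
pred₄-suc₄ 3F = refl

mod₄ : ℤ → Fin 4
mod₄ (+ 0)          = 0F
mod₄ (+ ℕ.suc m)    = suc₄ (mod₄ (+ m))
mod₄ -[1+ 0 ]       = 3F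
mod₄ -[1+ ℕ.suc m ] = pred₄ (mod₄ -[1+ m ])

mod₄-+1 : ∀ i → mod₄ (i + 1ℤ) ≡ suc₄ (mod₄ i)
mod₄-+1 (+ m) rewrite ℕ.+-comm m 1 = refl
mod₄-+1 -[1+ 0 ]       = refl
mod₄-+1 -[1+ ℕ.suc m ] = sym (suc₄-pred₄ (mod₄ -[1+ m ]))

mod₄--1 : ∀ i → mod₄ (i - 1ℤ) ≡ pred₄ (mod₄ i)
mod₄--1 (+ 0)       = refl
mod₄--1 (+ ℕ.suc m) = sym (pred₄-suc₄ (mod₄ (+ m)))
mod₄--1 -[1+ m ] rewrite ℕ.+-identityʳ m = refl

Torus : Set
Torus = Fin 4 × Fin 4

τ : V → Torus
τ (i , j) = mod₄ i , mod₄ j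

Nₜ : Torus → List Torus
Nₜ (x , y) = (suc₄ x , y) ∷ (pred₄ x , y) ∷ (x , suc₄ y) ∷ (x , pred₄ y) ∷ []

map-τ-N : ∀ v → map τ (N v) ≡ Nₜ (τ v)
map-τ-N (i , j) rewrite mod₄-+1 i | mod₄--1 i | mod₄-+1 j | mod₄--1 j = refl

τ-adjacent : ∀ {v w} → Adj v w → τ w ∈ Nₜ (τ v)
τ-adjacent {v} {w} v~w = subst (τ w ∈_) (map-τ-N v) (∈-map⁺ τ v~w)

tsum : (Torus → ℤ) → Torus → ℤ
tsum g p = foldr _+_ (+ 0) (map g (Nₜ p))

nsum-τ : ∀ g v → nsum (g ∘ τ) v ≡ tsum g (τ v)
nsum-τ g v = cong (foldr _+_ (+ 0)) (trans (map-∘ {g = g} {f = τ} (N v)) (cong (map g) (map-τ-N v)))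

foldr-+-linear : ∀ {A : Set} (a b : A → ℤ) X Y xs →
  foldr _+_ (+ 0) (map (λ q → a q * X + b q * Y) xs) ≡
  foldr _+_ (+ 0) (map a xs) * X + foldr _+_ (+ 0) (map b xs) * Y
foldr-+-linear a b X Y []       = refl
foldr-+-linear a b X Y (q ∷ qs) =
  trans (cong (_+_ (a q * X + b q * Y)) (foldr-+-linear a b X Y qs)) (distrib (a q) (b q) _ _ X Y)
  where distrib : ∀ a b A B X Y → a * X + b * Y + (A * X + B * Y) ≡ (a + A) * X + (b + B) * Y
        distrib = solve-∀

digit : Fin 2 → ℤ
digit i = + toℕ i

parity : Torus → Fin 2
parity (x , y) = (toℕ x ℕ.+ toℕ y) mod 2

perfectCode : Torus → Fin 2
perfectCode (0F , 0F) = 1F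
perfectCode (1F , 0F) = 1F
perfectCode (2F , 2F) = 1F
perfectCode (3F , 2F) = 1F
perfectCode _         = 0F

perfectCode-sum : ∀ x y → tsum (digit ∘ perfectCode) (x , y) ≡ 1ℤ
perfectCode-sum = toWitness {a? = all? λ x → all? λ y → tsum (digit ∘ perfectCode) (x , y) ≟ 1ℤ} _

twoDigit : ℤ → ℕ → Fin 2 × Fin 2 → ℤ
twoDigit X n (e , o) = digit e * X + digit o * + n

twoDigit-injectiveʳ : ∀ {X n e o o′} → n ≢ 0 → twoDigit X n (e , o) ≡ twoDigit X n (e , o′) → o ≡ o′
twoDigit-injectiveʳ {X} {n} {e} {o} {o′} n≢0 eq =
  toℕ-injective (ℤ.+-injective (ℤ.*-cancelʳ-≡ (digit o) (digit o′) (+ n) {{ℕ.≢-nonZero n≢0}}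
    (∙-cancelˡ (digit e * X) _ _ eq)))

∣[d-d′]*X⇒d≡d′ : ∀ {X n} e e′ → Signed._∣_ (+ n) ((digit e - digit e′) * X) → ¬ (+ n ∣ X) → e ≡ e′
∣[d-d′]*X⇒d≡d′ 0F 0F _ _ = refl
∣[d-d′]*X⇒d≡d′ 1F 1F _ _ = refl
∣[d-d′]*X⇒d≡d′ {X} {n} 0F 1F n∣-X n∤X =
  ⊥-elim (n∤X (∣⇒∣ᵤ (subst (Signed._∣_ (+ n)) (ℤ.neg-involutive X)
    (∣m⇒∣-m (subst (Signed._∣_ (+ n)) (ℤ.-1*i≡-i X) n∣-X)))))
∣[d-d′]*X⇒d≡d′ {X} {n} 1F 0F n∣X n∤X =
  ⊥-elim (n∤X (∣⇒∣ᵤ (subst (Signed._∣_ (+ n)) (ℤ.*-identityˡ X) n∣X)))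

twoDigit-injective : ∀ {X n} → n ≢ 0 → ¬ (+ n ∣ X) → Injective _≡_ _≡_ (twoDigit X n)
twoDigit-injective {X} {n} n≢0 n∤X {e , o} {e′ , o′} eq
  with ∣[d-d′]*X⇒d≡d′ {X} {n} e e′ (divides (digit o′ - digit o) difference) n∤X
  where
  open ≡-Reasoning
  difference : (digit e - digit e′) * X ≡ (digit o′ - digit o) * + n
  difference = begin
    (digit e - digit e′) * X                                ≡⟨ expand (digit e) (digit e′) (digit o) X (+ n) ⟩
    twoDigit X n (e , o) - (digit e′ * X + digit o * + n)    ≡⟨ cong (_- (digit e′ * X + digit o * + n)) eq ⟩
    twoDigit X n (e′ , o′) - (digit e′ * X + digit o * + n)  ≡⟨ collect (digit e′) (digit o′) (digit o) X (+ n) ⟩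
    (digit o′ - digit o) * + n                              ∎
    where
    expand : ∀ a a′ b X N → (a - a′) * X ≡ (a * X + b * N) - (a′ * X + b * N)
    expand = solve-∀
    collect : ∀ a′ b′ b X N → (a′ * X + b′ * N) - (a′ * X + b * N) ≡ (b′ - b) * N
    collect = solve-∀
... | refl = cong (e ,_) (twoDigit-injectiveʳ {X} {n} {e} n≢0 eq)

digitLabeling : (Torus → Fin 2) → ℤ → ℕ → Labeling
digitLabeling e X n v = twoDigit X n (e (τ v) , parity (τ v))

digitLabeling-open : ∀ {n k} e X c → (∀ p → tsum (digit ∘ e) p ≡ c) → (c * X) ≡ k [mod n ] →
                     OpenColoring n k (digitLabeling e X n)
digitLabeling-open {n} {k} e X c e-sum cX≡k v =
  ∣⇒∣ᵤ (subst (Signed._∣_ (+ n)) (sym split) (∣m∣n⇒∣m+n (∣ᵤ⇒∣ {+ n} {c * X - k} cX≡k) (∣n⇒∣m*n S ∣-refl)))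
  where
  open ≡-Reasoning
  g : Torus → ℤ
  g p = twoDigit X n (e p , parity p)
  S : ℤ
  S = tsum (digit ∘ parity) (τ v)
  split : nsum (digitLabeling e X n) v - k ≡ (c * X - k) + S * + n
  split = begin
    nsum (g ∘ τ) v - k                        ≡⟨ cong (_- k) (nsum-τ g v) ⟩
    tsum g (τ v) - k                          ≡⟨ cong (_- k) (foldr-+-linear (digit ∘ e) (digit ∘ parity) X (+ n) (Nₜ (τ v))) ⟩
    tsum (digit ∘ e) (τ v) * X + S * + n - k  ≡⟨ cong (λ z → z * X + S * + n - k) (e-sum (τ v)) ⟩
    c * X + S * + n - k                       ≡⟨ regroup (c * X) (S * + n) k ⟩
    (c * X - k) + S * + n                     ∎
    where regroup : ∀ a b k → a + b - k ≡ (a - k) + b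
          regroup = solve-∀

factor-proper : ∀ {ℓ m} (f : Fin m → ℤ) (κ : V → Fin m) → (∀ v → ℓ v ≡ f (κ v)) →
                Injective _≡_ _≡_ f → (∀ v w → Adj v w → κ v ≢ κ w) → Proper ℓ
factor-proper f κ factor f-inj κ-proper v w v~w ℓv≡ℓw =
  κ-proper v w v~w (f-inj (trans (sym (factor v)) (trans ℓv≡ℓw (factor w))))

factor-order : ∀ {ℓ m} (f : Fin m → ℤ) (κ : V → Fin m) → (∀ v → ℓ v ≡ f (κ v)) →
               Injective _≡_ _≡_ f → (∀ i → ∃ λ v → κ v ≡ i) → HasOrder ℓ m
factor-order f κ factor f-inj κ-onto =
  f , f-inj , (λ v → κ v , factor v) , λ i → proj₁ (κ-onto i) , trans (factor _) (cong f (proj₂ (κ-onto i)))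

torus-proper : ∀ {m} (κ : Torus → Fin m) → (∀ x y → All (λ q → κ q ≢ κ (x , y)) (Nₜ (x , y))) →
               ∀ v w → Adj v w → κ (τ v) ≢ κ (τ w)
torus-proper κ κ-proper v w v~w = ≢-sym (All.lookup (κ-proper _ _) (τ-adjacent v~w))

parity-proper : ∀ x y → All (λ q → parity q ≢ parity (x , y)) (Nₜ (x , y))
parity-proper = toWitness {a? = all? λ x → all? λ y →
  All.all? (λ q → ¬? (parity q Fin.≟ parity (x , y))) (Nₜ (x , y))} _

codeAndParity : Torus → Fin 4
codeAndParity p = combine (perfectCode p) (parity p)

codeAndParity-proper : ∀ x y → All (λ q → codeAndParity q ≢ codeAndParity (x , y)) (Nₜ (x , y))
codeAndParity-proper = toWitness {a? = all? λ x → all? λ y →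
  All.all? (λ q → ¬? (codeAndParity q Fin.≟ codeAndParity (x , y))) (Nₜ (x , y))} _

checkerboard : ∀ {n k X} → n ≢ 0 → (+ 4 * X) ≡ k [mod n ] →
               Σ Labeling λ ℓ → Proper ℓ × OpenColoring n k ℓ × HasOrder ℓ 2
checkerboard {n} {k} {X} n≢0 4X≡k =
    digitLabeling (λ _ → 1F) X n
  , factor-proper f (parity ∘ τ) (λ _ → refl) f-inj (torus-proper parity parity-proper)
  , digitLabeling-open (λ _ → 1F) X (+ 4) (λ _ → refl) 4X≡k
  , factor-order f (parity ∘ τ) (λ _ → refl) f-inj λ { 0F → (+ 0 , + 0) , refl ; 1F → (+ 1 , + 0) , refl }
  where
  f : Fin 2 → ℤ
  f o = twoDigit X n (1F , o)
  f-inj : Injective _≡_ _≡_ f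
  f-inj = twoDigit-injectiveʳ {X} {n} {1F} n≢0

perfectCode-labeling : ∀ {n k} → n ≢ 0 → ¬ (+ n ∣ k) →
                       Σ Labeling λ ℓ → Proper ℓ × OpenColoring n k ℓ × HasOrder ℓ 4
perfectCode-labeling {n} {k} n≢0 n∤k =
    digitLabeling perfectCode k n
  , factor-proper f (codeAndParity ∘ τ) factor f-inj (torus-proper codeAndParity codeAndParity-proper)
  , digitLabeling-open perfectCode k 1ℤ (λ (x , y) → perfectCode-sum x y) (≡-mod-reflexive (ℤ.*-identityˡ k))
  , factor-order f (codeAndParity ∘ τ) factor f-inj onto
  where
  f : Fin 4 → ℤ
  f = twoDigit k n ∘ remQuot 2
  factor : ∀ v → digitLabeling perfectCode k n v ≡ f (codeAndParity (τ v))
  factor v = cong (twoDigit k n) (sym (remQuot-combine (perfectCode (τ v)) (parity (τ v))))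
  f-inj : Injective _≡_ _≡_ f
  f-inj {i} {j} eq = trans (sym (combine-remQuot {2} 2 i))
    (trans (cong (uncurry combine) (twoDigit-injective {k} {n} n≢0 n∤k {remQuot 2 i} {remQuot 2 j} eq))
           (combine-remQuot {2} 2 j))
  onto : ∀ i → ∃ λ v → codeAndParity (τ v) ≡ i
  onto 0F = (+ 2 , + 0) , refl
  onto 1F = (+ 3 , + 0) , refl
  onto 2F = (+ 0 , + 0) , refl
  onto 3F = (+ 1 , + 0) , refl

theorem6p7 : (n : ℕ) (k : ℤ) → n ≥ 2 → ¬ (k ≡ + 0 [mod n ]) →
    ((+ gcd 4 n) ∣ k → Chi≡ n k 2) × (¬ ((+ gcd 4 n) ∣ k) → Chi≡ n k 4)
theorem6p7 n k n≥2 k≢0 = two-labels , four-labels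
  where
  n≢0 : n ≢ 0
  n≢0 = ℕ.m<n⇒n≢0 n≥2
  n∤k : ¬ (+ n ∣ k)
  n∤k n∣k = k≢0 (subst (+ n ∣_) (sym (ℤ.+-identityʳ k)) n∣k)
  two-labels : (+ gcd 4 n) ∣ k → Chi≡ n k 2
  two-labels g∣k = let X , 4X≡k = gcd∣⇒solvable 4 n g∣k in
    checkerboard {n} {k} {X} n≢0 4X≡k , λ _ _ proper _ → two-≤-order proper
  four-labels : ¬ ((+ gcd 4 n) ∣ k) → Chi≡ n k 4
  four-labels g∤k =
    perfectCode-labeling n≢0 n∤k , four-≤-order {n} {k} (λ X → g∤k ∘ solvable⇒gcd∣ 4 n {k} {X})
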